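{- If $B$ is a bipartite, well-covered graph with minimum degree at least $2$, then $B$ has isolatable vertices. In fact, for any vertex $x$ of $B$, the induced subgraph $B-N[x]$ has an isolated vertex.
   Context: Graphs are finite and simple. A graph is well-covered if all of its maximal independent sets have the same cardinality. A vertex $v$ of $B$ is isolatable if there is an independent set $I$ of $B$ such that $v$ is an isolated vertex of $B-N[I]$, where $N[I]$ denotes the closed neighborhood of $I$. -}

module Defs where

open import Data.Nat using (ℕ; _≤_)
open import Data.Bool using (Bool; true; false)
open import Data.Fin using (Fin)
open import Data.Fin.Subset using (Subset; _∈_; _∉_; _⊂_; ∣_∣; ⁅_⁆)
open import Data.Vec using (tabulate)
open import Data.Product using (Σ; ∃; _×_; _,_)
open import Data.Sum using (_⊎_)
open import Relation.Binary.PropositionalEquality using (_≡_; _≢_)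
open import Relation.Nullary using (¬_)

record Graph (n : ℕ) : Set where
  field
    adj     : Fin n → Fin n → Bool
    sym     : ∀ u v → adj u v ≡ adj v u
    irrefl  : ∀ v → adj v v ≡ false

module _ {n : ℕ} (G : Graph n) where
  open Graph G

  nbhd : Fin n → Subset n
  nbhd v = tabulate (λ u → adj v u)

  degree : Fin n → ℕ
  degree v = ∣ nbhd v ∣

  MinDegreeAtLeast : ℕ → Set
  MinDegreeAtLeast k = ∀ v → k ≤ degree v

  Bipartite : Set
  Bipartite = Σ (Fin n → Bool) λ c → ∀ u v → adj u v ≡ true → c u ≢ c v

  Independent : Subset n → Set
  Independent I = ∀ u v → u ∈ I → v ∈ I → adj u v ≡ false

  MaximalIndependent : Subset n → Set
  MaximalIndependent I = Independent I × (∀ J → I ⊂ J → ¬ Independent J)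

  WellCovered : Set
  WellCovered = ∀ I J → MaximalIndependent I → MaximalIndependent J → ∣ I ∣ ≡ ∣ J ∣

  InClosedNbhd : Subset n → Fin n → Set
  InClosedNbhd I v = v ∈ I ⊎ Σ (Fin n) λ u → u ∈ I × adj u v ≡ true

  IsolatedIn-N[_] : Subset n → Fin n → Set
  IsolatedIn-N[ I ] v =
    ¬ InClosedNbhd I v × (∀ w → ¬ InClosedNbhd I w → adj v w ≡ false)

  Isolatable : Fin n → Set
  Isolatable v = Σ (Subset n) λ I → Independent I × IsolatedIn-N[ I ] v

  HasIsolatedAfterRemoving-N[_] : Fin n → Set
  HasIsolatedAfterRemoving-N[ x ] = Σ (Fin n) λ v → IsolatedIn-N[ ⁅ x ⁆ ] v

-- Let x lie on the side X of a bipartition (X, Y) of B. Minimum degree 1 makes Y a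
-- maximal independent set, and I = {x} ∪ (Y − N(x)) is independent with
-- ∣ I ∣ = ∣ Y ∣ + 1 − deg x < ∣ Y ∣. By well-coveredness I is not maximal, so some
-- vertex z ∉ I has no neighbour in I. Such a z lies in X − N[x], and each of its
-- neighbours outside N[x] would belong to Y − N(x) ⊆ I; hence z is isolated in B − N[x].
module Submission where

open import Defs
open import Data.Nat using (ℕ; suc; _+_; _≤_; _<_; z≤n; s≤s)
open import Data.Nat.Properties using (≤-trans; ≤-reflexive; <-irrefl; n<1+n; +-suc; +-comm; +-monoˡ-≤; +-monoʳ-≤; module ≤-Reasoning)
open import Data.Fin using (Fin)
open import Data.Fin.Properties using (any?; all?; ¬∀⟶∃¬)
open import Data.Fin.Subset using (Subset; inside; outside; _∈_; _∉_; _⊆_; _∪_; _∩_; ∁; ∣_∣; ⁅_⁆; Nonempty)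
open import Data.Fin.Subset.Properties using (_∈?_; drop-∷-⊆; ∣p∣≤∣x∷p∣; nonempty?; Empty-unique; ∣⊥∣≡0; x∈⁅x⁆; x∈⁅y⁆⇒x≡y; ∣⁅x⁆∣≡1; x∈p∪q⁺; x∈p∪q⁻; x∈p∩q⁺; x∈p∩q⁻; x∉p⇒x∈∁p; x∈∁p⇒x∉p)
open import Data.Vec using ([]; _∷_; here; tabulate)
open import Data.Vec.Properties using (lookup∘tabulate; []=⇒lookup; lookup⇒[]=)
open import Data.Bool using (Bool; true; false; not)
open import Data.Bool.Properties using (¬-not; not-involutive) renaming (_≟_ to _≟ᵇ_)
open import Data.Product using (Σ; ∃-syntax; _×_; _,_; proj₁; proj₂)
open import Data.Sum using (_⊎_; inj₁; inj₂)
open import Data.Empty using (⊥-elim)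
open import Relation.Nullary using (¬_; Dec; yes; no; does; contradiction)
open import Relation.Nullary.Decidable using (dec-true; _×-dec_; _→-dec_; ¬?)
open import Relation.Binary.PropositionalEquality using (_≡_; _≢_; refl; sym; trans; cong; module ≡-Reasoning)
open import Function using (_∘_)

∣p∪q∣≤∣p∣+∣q∣ : ∀ {n} (p q : Subset n) → ∣ p ∪ q ∣ ≤ ∣ p ∣ + ∣ q ∣
∣p∪q∣≤∣p∣+∣q∣ []            []            = z≤n
∣p∪q∣≤∣p∣+∣q∣ (inside  ∷ p) (t       ∷ q) =
  s≤s (≤-trans (∣p∪q∣≤∣p∣+∣q∣ p q) (+-monoʳ-≤ ∣ p ∣ (∣p∣≤∣x∷p∣ t q)))
∣p∪q∣≤∣p∣+∣q∣ (outside ∷ p) (outside ∷ q) = ∣p∪q∣≤∣p∣+∣q∣ p q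
∣p∪q∣≤∣p∣+∣q∣ (outside ∷ p) (inside  ∷ q) =
  ≤-trans (s≤s (∣p∪q∣≤∣p∣+∣q∣ p q)) (≤-reflexive (sym (+-suc ∣ p ∣ ∣ q ∣)))

q⊆p⇒∣p∩∁q∣+∣q∣≡∣p∣ : ∀ {n} {p q : Subset n} → q ⊆ p → ∣ p ∩ ∁ q ∣ + ∣ q ∣ ≡ ∣ p ∣
q⊆p⇒∣p∩∁q∣+∣q∣≡∣p∣ {p = []}          {[]}          _   = refl
q⊆p⇒∣p∩∁q∣+∣q∣≡∣p∣ {p = outside ∷ p} {outside ∷ q} q⊆p = q⊆p⇒∣p∩∁q∣+∣q∣≡∣p∣ (drop-∷-⊆ q⊆p)
q⊆p⇒∣p∩∁q∣+∣q∣≡∣p∣ {p = inside  ∷ p} {outside ∷ q} q⊆p = cong suc (q⊆p⇒∣p∩∁q∣+∣q∣≡∣p∣ (drop-∷-⊆ q⊆p))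
q⊆p⇒∣p∩∁q∣+∣q∣≡∣p∣ {p = inside  ∷ p} {inside  ∷ q} q⊆p =
  trans (+-suc ∣ p ∩ ∁ q ∣ ∣ q ∣) (cong suc (q⊆p⇒∣p∩∁q∣+∣q∣≡∣p∣ (drop-∷-⊆ q⊆p)))
q⊆p⇒∣p∩∁q∣+∣q∣≡∣p∣ {p = outside ∷ p} {inside  ∷ q} q⊆p = contradiction (q⊆p here) λ ()

∈tabulate⁺ : ∀ {n} {f : Fin n → Bool} {i} → f i ≡ true → i ∈ tabulate f
∈tabulate⁺ {f = f} {i} fi = lookup⇒[]= i (tabulate f) (trans (lookup∘tabulate f i) fi)

∈tabulate⁻ : ∀ {n} {f : Fin n → Bool} {i} → i ∈ tabulate f → f i ≡ true
∈tabulate⁻ {f = f} {i} i∈ = trans (sym (lookup∘tabulate f i)) ([]=⇒lookup i∈)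

0<∣p∣⇒nonempty : ∀ {n} (p : Subset n) → 0 < ∣ p ∣ → Nonempty p
0<∣p∣⇒nonempty {n} p 0<∣p∣ with nonempty? p
... | yes nonempty = nonempty
... | no  empty    = ⊥-elim (<-irrefl (sym ∣p∣≡0) 0<∣p∣)
  where
  ∣p∣≡0 : ∣ p ∣ ≡ 0
  ∣p∣≡0 = trans (cong ∣_∣ (Empty-unique empty)) (∣⊥∣≡0 n)

module _ {n : ℕ} (G : Graph n) where
  open Graph G using (adj; irrefl) renaming (sym to adj-sym)

  HasNeighbourIn : Subset n → Fin n → Set
  HasNeighbourIn I z = ∃[ u ] u ∈ I × adj u z ≡ true

  Dominates : Subset n → Set
  Dominates I = ∀ z → z ∉ I → HasNeighbourIn I z

  dominated? : ∀ I z → Dec (z ∉ I → HasNeighbourIn I z)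
  dominated? I z = ¬? (z ∈? I) →-dec any? λ u → (u ∈? I) ×-dec (adj u z ≟ᵇ true)

  dominates-or-undominated : ∀ I → Dominates I ⊎ ∃[ z ] z ∉ I × ¬ HasNeighbourIn I z
  dominates-or-undominated I with all? (dominated? I)
  ... | yes dom = inj₁ dom
  ... | no ¬dom with ¬∀⟶∃¬ n _ (dominated? I) ¬dom
  ...   | z , ¬dominated = inj₂ (z , (λ z∈I → ¬dominated λ z∉I → contradiction z∈I z∉I)
                                    , (λ nbr → ¬dominated λ _ → nbr))

  independent-⁅x⁆ : ∀ x → Independent G ⁅ x ⁆
  independent-⁅x⁆ x u v u∈⁅x⁆ v∈⁅x⁆ rewrite x∈⁅y⁆⇒x≡y x u∈⁅x⁆ | x∈⁅y⁆⇒x≡y x v∈⁅x⁆ = irrefl x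

  independent-⊆ : ∀ {I J} → J ⊆ I → Independent G I → Independent G J
  independent-⊆ J⊆I indI u v u∈J v∈J = indI u v (J⊆I u∈J) (J⊆I v∈J)

  independent-∪ : ∀ {I J} → Independent G I → Independent G J →
                  (∀ u v → u ∈ I → v ∈ J → adj u v ≡ false) → Independent G (I ∪ J)
  independent-∪ {I} {J} indI indJ cross u v u∈ v∈ with x∈p∪q⁻ I J u∈ | x∈p∪q⁻ I J v∈
  ... | inj₁ u∈I | inj₁ v∈I = indI u v u∈I v∈I
  ... | inj₁ u∈I | inj₂ v∈J = cross u v u∈I v∈J
  ... | inj₂ u∈J | inj₁ v∈I = trans (adj-sym u v) (cross v u v∈I u∈J)
  ... | inj₂ u∈J | inj₂ v∈J = indJ u v u∈J v∈J

  independent∧dominates⇒maximal : ∀ {I} → Independent G I → Dominates I → MaximalIndependent G I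
  independent∧dominates⇒maximal indI dom = indI , λ where
    J (I⊆J , z , z∈J , z∉I) indJ → let (u , u∈I , adj-uz) = dom z z∉I in
      contradiction (trans (sym adj-uz) (indJ u z (I⊆J u∈I) z∈J)) λ ()

  ∉nbhd⇒nonadjacent : ∀ {x v} → v ∉ nbhd G x → adj x v ≡ false
  ∉nbhd⇒nonadjacent v∉N = ¬-not (v∉N ∘ ∈tabulate⁺)

  undominated⇒∉N[] : ∀ {I J z} → J ⊆ I → z ∉ I → ¬ HasNeighbourIn I z → ¬ InClosedNbhd G J z
  undominated⇒∉N[] J⊆I z∉I _     (inj₁ z∈J)             = z∉I (J⊆I z∈J)
  undominated⇒∉N[] J⊆I _   noNbr (inj₂ (u , u∈J , adj-uz)) = noNbr (u , J⊆I u∈J , adj-uz)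

module Bipartition {n : ℕ} (G : Graph n) (c : Fin n → Bool)
                   (proper : ∀ u v → Graph.adj G u v ≡ true → c u ≢ c v) where
  open Graph G using (adj) renaming (sym to adj-sym)

  colourClass : Bool → Subset n
  colourClass b = tabulate λ v → does (c v ≟ᵇ b)

  ∈colourClass⁺ : ∀ {v b} → c v ≡ b → v ∈ colourClass b
  ∈colourClass⁺ {v} {b} cv≡b = ∈tabulate⁺ (dec-true (c v ≟ᵇ b) cv≡b)

  ∈colourClass⁻ : ∀ {v b} → v ∈ colourClass b → c v ≡ b
  ∈colourClass⁻ {v} {b} v∈ with c v ≟ᵇ b | ∈tabulate⁻ {f = λ w → does (c w ≟ᵇ b)} v∈
  ... | yes cv≡b | _  = cv≡b
  ... | no  _    | ()

  ∉colourClass⁻ : ∀ {v b} → v ∉ colourClass b → c v ≡ not b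
  ∉colourClass⁻ v∉ = ¬-not (v∉ ∘ ∈colourClass⁺)

  adjacent⇒opposite : ∀ {u v} → adj u v ≡ true → c v ≡ not (c u)
  adjacent⇒opposite {u} {v} adj-uv = ¬-not (proper u v adj-uv ∘ sym)

  colourClass-independent : ∀ {b} → Independent G (colourClass b)
  colourClass-independent u v u∈ v∈ =
    ¬-not λ adj-uv → proper u v adj-uv (trans (∈colourClass⁻ u∈) (sym (∈colourClass⁻ v∈)))

  colourClass-dominates : ∀ {b} → MinDegreeAtLeast G 1 → Dominates G (colourClass b)
  colourClass-dominates {b} minDeg z z∉ with 0<∣p∣⇒nonempty (nbhd G z) (minDeg z)
  ... | u , u∈N = u , ∈colourClass⁺ cu≡b , trans (adj-sym u z) adj-zu
    where
    open ≡-Reasoning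
    adj-zu : adj z u ≡ true
    adj-zu = ∈tabulate⁻ u∈N
    cu≡b : c u ≡ b
    cu≡b = begin
      c u           ≡⟨ adjacent⇒opposite adj-zu ⟩
      not (c z)     ≡⟨ cong not (∉colourClass⁻ z∉) ⟩
      not (not b)   ≡⟨ not-involutive b ⟩
      b             ∎

  module _ (x : Fin n) where
    Y : Subset n
    Y = colourClass (not (c x))

    Y∖N : Subset n
    Y∖N = Y ∩ ∁ (nbhd G x)

    I : Subset n
    I = ⁅ x ⁆ ∪ Y∖N

    nbhd⊆Y : nbhd G x ⊆ Y
    nbhd⊆Y v∈N = ∈colourClass⁺ (adjacent⇒opposite (∈tabulate⁻ v∈N))

    I-independent : Independent G I
    I-independent = independent-∪ G (independent-⁅x⁆ G x) (independent-⊆ G Y∖N⊆Y colourClass-independent) cross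
      where
      Y∖N⊆Y : Y∖N ⊆ Y
      Y∖N⊆Y v∈ = proj₁ (x∈p∩q⁻ Y _ v∈)
      cross : ∀ u v → u ∈ ⁅ x ⁆ → v ∈ Y∖N → adj u v ≡ false
      cross u v u∈⁅x⁆ v∈ rewrite x∈⁅y⁆⇒x≡y x u∈⁅x⁆ =
        ∉nbhd⇒nonadjacent G (x∈∁p⇒x∉p (proj₂ (x∈p∩q⁻ Y _ v∈)))

    ∈I⁺ : ∀ {v} → v ∈ Y → ¬ InClosedNbhd G ⁅ x ⁆ v → v ∈ I
    ∈I⁺ v∈Y v∉N[x] = x∈p∪q⁺ (inj₂ (x∈p∩q⁺ (v∈Y , x∉p⇒x∈∁p λ v∈N →
                        v∉N[x] (inj₂ (x , x∈⁅x⁆ x , ∈tabulate⁻ v∈N)))))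

    undominated⇒isolated : ∀ {z} → z ∉ I → ¬ HasNeighbourIn G I z → IsolatedIn-N[_] G ⁅ x ⁆ z
    undominated⇒isolated {z} z∉I noNbr =
      z∉N[x] , λ w w∉N[x] → ¬-not λ adj-zw → noNbr (w , ∈I⁺ (w∈Y adj-zw) w∉N[x] , trans (adj-sym w z) adj-zw)
      where
      ⁅x⁆⊆I : ⁅ x ⁆ ⊆ I
      ⁅x⁆⊆I = x∈p∪q⁺ ∘ inj₁
      z∉N[x] : ¬ InClosedNbhd G ⁅ x ⁆ z
      z∉N[x] = undominated⇒∉N[] G ⁅x⁆⊆I z∉I noNbr
      cz≡cx : c z ≡ c x
      cz≡cx = trans (∉colourClass⁻ λ z∈Y → z∉I (∈I⁺ z∈Y z∉N[x])) (not-involutive (c x))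
      w∈Y : ∀ {w} → adj z w ≡ true → w ∈ Y
      w∈Y adj-zw = ∈colourClass⁺ (trans (adjacent⇒opposite adj-zw) (cong not cz≡cx))

    ∣I∣<∣Y∣ : 2 ≤ degree G x → ∣ I ∣ < ∣ Y ∣
    ∣I∣<∣Y∣ 2≤deg = begin-strict
      ∣ I ∣                          ≤⟨ ∣p∪q∣≤∣p∣+∣q∣ ⁅ x ⁆ Y∖N ⟩
      ∣ ⁅ x ⁆ ∣ + ∣ Y∖N ∣            ≡⟨ cong (_+ ∣ Y∖N ∣) (∣⁅x⁆∣≡1 x) ⟩
      1 + ∣ Y∖N ∣                    <⟨ n<1+n (1 + ∣ Y∖N ∣) ⟩
      2 + ∣ Y∖N ∣                    ≤⟨ +-monoˡ-≤ ∣ Y∖N ∣ 2≤deg ⟩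
      degree G x + ∣ Y∖N ∣           ≡⟨ +-comm (degree G x) ∣ Y∖N ∣ ⟩
      ∣ Y∖N ∣ + ∣ nbhd G x ∣         ≡⟨ q⊆p⇒∣p∩∁q∣+∣q∣≡∣p∣ nbhd⊆Y ⟩
      ∣ Y ∣                          ∎
      where open ≤-Reasoning

  hasIsolatedAfterRemoving-N[x] : WellCovered G → MinDegreeAtLeast G 2 → ∀ x → HasIsolatedAfterRemoving-N[_] G x
  hasIsolatedAfterRemoving-N[x] wc minDeg x with dominates-or-undominated G (I x)
  ... | inj₂ (z , z∉I , noNbr) = z , undominated⇒isolated x z∉I noNbr
  ... | inj₁ dominated = ⊥-elim (<-irrefl (wc (I x) (Y x) I-maximal Y-maximal) (∣I∣<∣Y∣ x (minDeg x)))
    where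
    I-maximal : MaximalIndependent G (I x)
    I-maximal = independent∧dominates⇒maximal G (I-independent x) dominated
    Y-maximal : MaximalIndependent G (Y x)
    Y-maximal = independent∧dominates⇒maximal G colourClass-independent
                  (colourClass-dominates λ v → ≤-trans (s≤s z≤n) (minDeg v))

corollary3p3 : ∀ {n : ℕ} (B : Graph n) → Bipartite B → WellCovered B → MinDegreeAtLeast B 2 →
    ((Fin n → Σ (Fin n) λ v → Isolatable B v) × (∀ x → HasIsolatedAfterRemoving-N[_] B x))
corollary3p3 B (c , proper) wc minDeg = isolatable , isolated
  where
  isolated : ∀ x → HasIsolatedAfterRemoving-N[_] B x
  isolated = Bipartition.hasIsolatedAfterRemoving-N[x] B c proper wc minDeg
  isolatable : Fin _ → Σ (Fin _) λ v → Isolatable B v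
  isolatable x with isolated x
  ... | v , v-isolated = v , ⁅ x ⁆ , independent-⁅x⁆ B x , v-isolated
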